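{- There is a deterministic distributed algorithm in the LOCAL model that, given a $2^{ -4}$-fractional $14$-approximate maximum $b$-matching in a 2-colored bipartite graph, computes in $O(1)$ rounds an integral $434$-approximate maximum $b$-matching.
   Context: LOCAL model: the network is an undirected simple graph $G=(V,E)$; each node has a unique identifier and knows $b_v$ and the values on its incident edges; synchronous rounds, in each of which each node does local computation and sends a message of arbitrary size to each neighbor. A 2-colored bipartite graph is a bipartite graph with a proper 2-coloring of its nodes known to the nodes. Given integers $1\le b_v\le d_G(v)$, a fractional $b$-matching is an assignment $x_e\in[0,1]$ with $\sum_{e\ni v}x_e\le b_v$ for all $v$; it is integral if all $x_e\in\{0,1\}$; it is $2^{ -i}$-fractional if every $x_e\in\{0\}\cup\{2^{ -j}:0\le j\le i\}$; it is $c$-approximate if $c\sum_e x_e\ge|M^*|$ for a maximum integral $b$-matching $M^*$. -}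

module Defs where

open import Data.Nat using (ℕ; zero; suc; _+_; _*_; _^_; _≤_)
open import Data.Fin using (Fin)
open import Data.Fin.Properties using (_≟_)
open import Data.Bool using (Bool; true; false; if_then_else_)
open import Data.List using (List; []; _∷_; map; length; filterᵇ; allFin)
open import Data.Nat.ListAction using (sum)
open import Data.Product using (Σ; ∃; _×_; _,_)
open import Data.Sum using (_⊎_)
open import Relation.Nullary using (¬_; yes; no)
open import Relation.Binary.PropositionalEquality using (_≡_; _≢_)
open import Function.Definitions using (Injective)

record Graph (n : ℕ) : Set where
  field
    adj    : Fin n → Fin n → Bool
    sym    : ∀ u v → adj u v ≡ adj v u
    irrefl : ∀ v → adj v v ≡ false
open Graph public

-- neighbours of v (in the order of Fin n; this order plays the role of
-- an adversarial port numbering)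
nbrs : ∀ {n} → Graph n → Fin n → List (Fin n)
nbrs {n} G v = filterᵇ (adj G v) (allFin n)

deg : ∀ {n} → Graph n → Fin n → ℕ
deg G v = length (nbrs G v)

indexOf : ∀ {n} → Fin n → List (Fin n) → ℕ
indexOf u [] = zero
indexOf u (w ∷ ws) with u ≟ w
... | yes _ = zero
... | no  _ = suc (indexOf u ws)

portOf : ∀ {n} → Graph n → Fin n → Fin n → ℕ
portOf G v u = indexOf u (nbrs G v)

-- Values on edges: a function on ordered pairs (only values on edges matter)

EdgeFun : ℕ → Set
EdgeFun n = Fin n → Fin n → ℕ

load : ∀ {n} → Graph n → EdgeFun n → Fin n → ℕ
load G x v = sum (map (x v) (nbrs G v))

-- sum over all ordered pairs (u,v) with uv ∈ E; equals 2 · Σ_{e ∈ E} x_e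
-- for symmetric x
total2 : ∀ {n} → Graph n → EdgeFun n → ℕ
total2 {n} G x = sum (map (load G x) (allFin n))

Symmetric : ∀ {n} → Graph n → EdgeFun n → Set
Symmetric G x = ∀ u v → adj G u v ≡ true → x u v ≡ x v u

IntegralBMatching : ∀ {n} → Graph n → (Fin n → ℕ) → EdgeFun n → Set
IntegralBMatching G b y =
  Symmetric G y × (∀ u v → y u v ≤ 1) × (∀ v → load G y v ≤ b v)

-- A 2^{-4}-fractional value x_e is encoded as the natural number 16·x_e,
-- which must lie in {0} ∪ {2^j : 0 ≤ j ≤ 4}  (i.e. x_e ∈ {0} ∪ {2^{-j} : 0 ≤ j ≤ 4}).
Dyadic4 : ℕ → Set
Dyadic4 k = k ≡ 0 ⊎ Σ ℕ (λ j → j ≤ 4 × k ≡ 2 ^ j)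

Frac4BMatching : ∀ {n} → Graph n → (Fin n → ℕ) → EdgeFun n → Set
Frac4BMatching G b x =
  Symmetric G x × (∀ u v → Dyadic4 (x u v)) × (∀ v → load G x v ≤ 16 * b v)

-- c-approximate (for the 16-scaled fractional matching x):
-- c · Σ_e x_e ≥ |M*|  ⇔  for every integral b-matching M, 16·|M| ≤ c·(16 Σ_e x_e)
Frac4Approx : ∀ {n} → ℕ → Graph n → (Fin n → ℕ) → EdgeFun n → Set
Frac4Approx c G b x =
  ∀ M → IntegralBMatching G b M → 16 * total2 G M ≤ c * total2 G x

IntApprox : ∀ {n} → ℕ → Graph n → (Fin n → ℕ) → EdgeFun n → Set
IntApprox c G b y =
  ∀ M → IntegralBMatching G b M → total2 G M ≤ c * total2 G y

ProperColouring : ∀ {n} → Graph n → (Fin n → Bool) → Set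
ProperColouring G col = ∀ u v → adj G u v ≡ true → col u ≢ col v

ValidB : ∀ {n} → Graph n → (Fin n → ℕ) → Set
ValidB G b = ∀ v → 1 ≤ b v × b v ≤ deg G v

-- Deterministic LOCAL algorithms (arbitrary message size, arbitrary local
-- computation).

record LocalAlg : Set₁ where
  field
    State  : Set
    Msg    : Set
    init   : (myId : ℕ) → (myB : ℕ) → (myColour : Bool) →
             (incidentValues : List ℕ) → State
    send   : State → (port : ℕ) → Msg
    recv   : State → List Msg → State
    output : State → (port : ℕ) → Bool
open LocalAlg public

module _ (A : LocalAlg) {n : ℕ} (G : Graph n) (ident : Fin n → ℕ)
         (col : Fin n → Bool) (b : Fin n → ℕ) (x : EdgeFun n) where

  initial : Fin n → State A
  initial v = init A (ident v) (b v) (col v) (map (x v) (nbrs G v))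

  step : (Fin n → State A) → Fin n → State A
  step st v = recv A (st v) (map (λ u → send A (st u) (portOf G u v)) (nbrs G v))

  run : ℕ → Fin n → State A
  run zero    = initial
  run (suc r) = step (run r)

  result : ℕ → EdgeFun n
  result r v u =
    if adj G v u then (if output A (run r v) (portOf G v u) then 1 else 0) else 0

module Submission where

-- The algorithm is the classical two-round "propose / accept" rounding on a
-- 2-coloured bipartite graph (black = colour true, white = colour false).
-- Round 1: every black node v proposes along the first b_v incident edges
-- carrying a positive fractional value.  Round 2: every white node u accepts
-- the first b_u proposals it received.  The accepted edges form the output Y.
--
-- Y is an integral b-matching: it is symmetric because both endpoints output
-- the same acceptance bit, a white node accepts at most b_u edges, and a black
-- node can only have accepted edges among its at most b_v proposals.
--
-- For the approximation let P be the set of proposed edges.  Every value of the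
-- 16-scaled input x is at most 16, so at a black node v
--   load_x(v) ≤ 16 · min(b_v, #positive edges) = 16 · load_P(v),
-- and at a white node u the #proposals k received satisfies k ≤ load_x(u) ≤ 16 b_u,
-- hence k ≤ 16 · min(b_u, k) = 16 · load_Y(u).  In a properly 2-coloured graph a
-- symmetric edge function has the same total load on both colour classes, so
-- such one-sided load comparisons lift to totals: Σx ≤ 16 ΣP ≤ 256 ΣY.  With
-- the 14-approximation of x this gives |M| ≤ 14·256/16 · |Y| = 224 |Y| ≤ 434 |Y|.

open import Defs hiding (sym)
open import Data.Nat using (ℕ; zero; suc; _+_; _*_; _≤_; _⊓_; z≤n; s≤s)
open import Data.Nat.Properties
  using (≤-refl; ≤-trans; ≤-reflexive; +-mono-≤; +-identityʳ; *-zeroʳ; *-identityʳ; *-distribˡ-+;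
         *-distribˡ-⊓; *-assoc; *-monoʳ-≤; *-monoˡ-≤; *-cancelˡ-≤; ⊓-glb; m⊓n≤m; m≤n*m; m≤m+n;
         ^-monoʳ-≤; suc-injective; +-commutativeSemigroup; module ≤-Reasoning)
open import Algebra.Properties.CommutativeSemigroup +-commutativeSemigroup using (interchange)
open import Data.Fin using (Fin)
open import Data.Fin.Properties using (_≟_)
open import Data.Bool using (Bool; true; false; if_then_else_; not)
open import Data.Bool.Properties using (¬-not; T-≡) renaming (_≟_ to _≟ᴮ_)
open import Data.List using (List; []; _∷_; map; length; filterᵇ; allFin)
open import Data.List.Properties using (length-map; map-∘; map-cong-local)
open import Data.List.Membership.Propositional using (_∈_)
open import Data.List.Membership.Propositional.Properties using (∈-filter⁺; ∈-filter⁻; ∈-allFin)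
open import Data.List.Relation.Unary.Any using (here; there)
open import Data.List.Relation.Unary.All as All using (All; []; _∷_)
open import Data.List.Relation.Unary.All.Properties using (map⁺)
open import Data.List.Relation.Unary.Unique.Propositional using (Unique; _∷_)
open import Data.List.Relation.Unary.Unique.Propositional.Properties using (filter⁺; allFin⁺)
open import Data.Nat.ListAction using (sum)
open import Data.Product using (Σ; _×_; _,_; proj₁; proj₂)
open import Data.Sum using (_⊎_; inj₁; inj₂)
open import Function using (_∘_)
open import Function.Bundles using (Equivalence)
open import Function.Definitions using (Injective)
open import Relation.Binary.PropositionalEquality
open import Relation.Nullary using (yes; no; does; contradiction)
open import Relation.Nullary.Decidable using (T?)

module _ {A : Set} where

  sum-cong∈ : ∀ (f g : A → ℕ) l → (∀ {a} → a ∈ l → f a ≡ g a) →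
              sum (map f l) ≡ sum (map g l)
  sum-cong∈ f g []      eq = refl
  sum-cong∈ f g (a ∷ l) eq = cong₂ _+_ (eq (here refl)) (sum-cong∈ f g l (eq ∘ there))

  sum-mono∈ : ∀ (f g : A → ℕ) l → (∀ {a} → a ∈ l → f a ≤ g a) →
              sum (map f l) ≤ sum (map g l)
  sum-mono∈ f g []      le = z≤n
  sum-mono∈ f g (a ∷ l) le = +-mono-≤ (le (here refl)) (sum-mono∈ f g l (le ∘ there))

  sum-zeros : ∀ (l : List A) → sum (map (λ _ → 0) l) ≡ 0
  sum-zeros []      = refl
  sum-zeros (_ ∷ l) = sum-zeros l

  sum-map-+ : ∀ (f g : A → ℕ) l →
              sum (map (λ a → f a + g a) l) ≡ sum (map f l) + sum (map g l)
  sum-map-+ f g []      = refl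
  sum-map-+ f g (a ∷ l) = trans (cong (f a + g a +_) (sum-map-+ f g l))
                                (interchange (f a) (g a) _ _)

  sum-map-* : ∀ k (f : A → ℕ) l → sum (map (λ a → k * f a) l) ≡ k * sum (map f l)
  sum-map-* k f []      = sym (*-zeroʳ k)
  sum-map-* k f (a ∷ l) = trans (cong (k * f a +_) (sum-map-* k f l))
                                (sym (*-distribˡ-+ k (f a) _))

  sum-when : ∀ c (h : A → ℕ) l →
             (if c then sum (map h l) else 0) ≡ sum (map (λ a → if c then h a else 0) l)
  sum-when true  h l = refl
  sum-when false h l = sym (sum-zeros l)

  sum-filterᵇ : ∀ (p : A → Bool) (h : A → ℕ) l →
                sum (map h (filterᵇ p l)) ≡ sum (map (λ a → if p a then h a else 0) l)
  sum-filterᵇ p h []      = refl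
  sum-filterᵇ p h (a ∷ l) with p a
  ... | true  = cong (h a +_) (sum-filterᵇ p h l)
  ... | false = sum-filterᵇ p h l

sum-swap : ∀ {A C : Set} (g : A → C → ℕ) (l₁ : List A) (l₂ : List C) →
           sum (map (λ a → sum (map (g a) l₂)) l₁) ≡ sum (map (λ c → sum (map (λ a → g a c) l₁)) l₂)
sum-swap g []       l₂ = sym (sum-zeros l₂)
sum-swap g (a ∷ l₁) l₂ = trans (cong (sum (map (g a) l₂) +_) (sum-swap g l₁ l₂))
                               (sym (sum-map-+ (g a) (λ c → sum (map (λ a′ → g a′ c) l₁)) l₂))

≤-*-⊓ : ∀ c {m} p q → m ≤ c * p → m ≤ c * q → m ≤ c * (p ⊓ q)
≤-*-⊓ c p q h₁ h₂ = subst (_ ≤_) (sym (*-distribˡ-⊓ c p q)) (⊓-glb h₁ h₂)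

at : {B : Set} → B → List B → ℕ → B
at d []      i       = d
at d (a ∷ l) zero    = a
at d (a ∷ l) (suc i) = at d l i

at-map : {B C : Set} (g : B → C) (d : B) (l : List B) (i : ℕ) →
         at (g d) (map g l) i ≡ g (at d l i)
at-map g d []      i       = refl
at-map g d (a ∷ l) zero    = refl
at-map g d (a ∷ l) (suc i) = at-map g d l i

module _ {n : ℕ} where

  indexOf-head : ∀ (w : Fin n) ws → indexOf w (w ∷ ws) ≡ 0
  indexOf-head w ws with w ≟ w
  ... | yes _   = refl
  ... | no  w≢w = contradiction refl w≢w

  indexOf-tail : ∀ {w u : Fin n} → w ≢ u → ∀ ws → indexOf u (w ∷ ws) ≡ suc (indexOf u ws)
  indexOf-tail {w} {u} w≢u ws with u ≟ w
  ... | yes u≡w = contradiction (sym u≡w) w≢u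
  ... | no  _   = refl

  at-port : ∀ {B : Set} (d : B) (g : Fin n → B) {u} l → u ∈ l →
            at d (map g l) (indexOf u l) ≡ g u
  at-port d g {u} (w ∷ ws) u∈l with u ≟ w
  at-port d g (w ∷ ws) u∈l        | yes u≡w = cong g (sym u≡w)
  at-port d g (w ∷ ws) (here u≡w) | no  u≢w = contradiction u≡w u≢w
  at-port d g (w ∷ ws) (there u∈) | no  _   = at-port d g ws u∈

  read-by-ports : ∀ {B : Set} (d : B) (l : List (Fin n)) (K : List B) →
                  Unique l → length K ≡ length l →
                  map (λ u → at d K (indexOf u l)) l ≡ K
  read-by-ports d []       []      _              _   = refl
  read-by-ports d (w ∷ ws) (k ∷ K) (w∉ws ∷ uniq) len =
    cong₂ _∷_ (cong (at d (k ∷ K)) (indexOf-head w ws))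
              (trans (map-cong-local (All.map (λ w≢u → cong (at d (k ∷ K)) (indexOf-tail w≢u ws)) w∉ws))
                     (read-by-ports d ws K uniq (suc-injective len)))

bit : Bool → ℕ
bit c = if c then 1 else 0

bit≤1 : ∀ c → bit c ≤ 1
bit≤1 true  = s≤s z≤n
bit≤1 false = z≤n

trues : List Bool → ℕ
trues K = sum (map bit K)

sum-by-ports : ∀ {n} (l : List (Fin n)) (K : List Bool) → Unique l → length K ≡ length l →
               sum (map (λ u → bit (at false K (indexOf u l))) l) ≡ trues K
sum-by-ports l K uniq len =
  cong sum (trans (map-∘ l) (cong (map bit) (read-by-ports false l K uniq len)))

firstTrues : ℕ → List Bool → List Bool
firstTrues k       []           = []
firstTrues zero    (c ∷ cs)     = false ∷ firstTrues zero cs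
firstTrues (suc k) (true ∷ cs)  = true ∷ firstTrues k cs
firstTrues (suc k) (false ∷ cs) = false ∷ firstTrues (suc k) cs

length-firstTrues : ∀ k L → length (firstTrues k L) ≡ length L
length-firstTrues k       []           = refl
length-firstTrues zero    (c ∷ cs)     = cong suc (length-firstTrues zero cs)
length-firstTrues (suc k) (true ∷ cs)  = cong suc (length-firstTrues k cs)
length-firstTrues (suc k) (false ∷ cs) = cong suc (length-firstTrues (suc k) cs)

trues-firstTrues : ∀ k L → trues (firstTrues k L) ≡ k ⊓ trues L
trues-firstTrues zero    []           = refl
trues-firstTrues (suc k) []           = refl
trues-firstTrues zero    (c ∷ cs)     = trues-firstTrues zero cs
trues-firstTrues (suc k) (true ∷ cs)  = cong suc (trues-firstTrues k cs)
trues-firstTrues (suc k) (false ∷ cs) = trues-firstTrues (suc k) cs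

firstTrues-below : ∀ k L i → bit (at false (firstTrues k L) i) ≤ bit (at false L i)
firstTrues-below k       []           i       = z≤n
firstTrues-below zero    (c ∷ cs)     zero    = z≤n
firstTrues-below zero    (c ∷ cs)     (suc i) = firstTrues-below zero cs i
firstTrues-below (suc k) (true ∷ cs)  zero    = ≤-refl
firstTrues-below (suc k) (true ∷ cs)  (suc i) = firstTrues-below k cs i
firstTrues-below (suc k) (false ∷ cs) zero    = z≤n
firstTrues-below (suc k) (false ∷ cs) (suc i) = firstTrues-below (suc k) cs i

positive : ℕ → Bool
positive zero    = false
positive (suc _) = true

bit-positive : ∀ k → bit (positive k) ≤ k
bit-positive zero    = z≤n
bit-positive (suc k) = s≤s z≤n

sum≤cap*positives : ∀ c xs → All (_≤ c) xs → sum xs ≤ c * trues (map positive xs)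
sum≤cap*positives c []           []             = z≤n
sum≤cap*positives c (zero ∷ xs)  (_ ∷ bounds)   = sum≤cap*positives c xs bounds
sum≤cap*positives c (suc a ∷ xs) (a≤c ∷ bounds) = begin
  suc a + sum xs                        ≤⟨ +-mono-≤ a≤c (sum≤cap*positives c xs bounds) ⟩
  c + c * trues (map positive xs)       ≡⟨ cong (_+ c * trues (map positive xs)) (sym (*-identityʳ c)) ⟩
  c * 1 + c * trues (map positive xs)   ≡⟨ sym (*-distribˡ-+ c 1 _) ⟩
  c * (1 + trues (map positive xs))     ∎
  where open ≤-Reasoning

module Neighbourhoods {n : ℕ} (G : Graph n) where

  ∈-nbrs⁺ : ∀ {v u} → adj G v u ≡ true → u ∈ nbrs G v
  ∈-nbrs⁺ e = ∈-filter⁺ (T? ∘ adj G _) (∈-allFin _) (Equivalence.from T-≡ e)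

  ∈-nbrs⁻ : ∀ {v u} → u ∈ nbrs G v → adj G v u ≡ true
  ∈-nbrs⁻ u∈ = Equivalence.to T-≡ (proj₂ (∈-filter⁻ (T? ∘ adj G _) {xs = allFin n} u∈))

  nbrs-unique : ∀ v → Unique (nbrs G v)
  nbrs-unique v = filter⁺ (T? ∘ adj G v) (allFin⁺ n)

  adj-sym : ∀ {v u} → adj G v u ≡ true → adj G u v ≡ true
  adj-sym {v} {u} e = trans (Graph.sym G u v) e

  -- Σ_v Σ_{u ~ v} g v u = Σ_v Σ_{u ~ v} g u v: both sum g over ordered edges.
  edge-sum-swap : ∀ (g : Fin n → Fin n → ℕ) →
    sum (map (λ v → sum (map (g v) (nbrs G v))) (allFin n)) ≡
    sum (map (λ v → sum (map (λ u → g u v) (nbrs G v))) (allFin n))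
  edge-sum-swap g = begin
    sum (map (λ v → sum (map (g v) (nbrs G v))) V)
      ≡⟨ sum-cong∈ _ _ V (λ {v} _ → sum-filterᵇ (adj G v) (g v) V) ⟩
    sum (map (λ v → sum (map (λ u → if adj G v u then g v u else 0) V)) V)
      ≡⟨ sum-swap (λ v u → if adj G v u then g v u else 0) V V ⟩
    sum (map (λ u → sum (map (λ v → if adj G v u then g v u else 0) V)) V)
      ≡⟨ sum-cong∈ _ _ V (λ {u} _ → sum-cong∈ _ _ V (λ {v} _ →
           cong (if_then g v u else 0) (Graph.sym G v u))) ⟩
    sum (map (λ u → sum (map (λ v → if adj G u v then g v u else 0) V)) V)
      ≡⟨ sum-cong∈ _ _ V (λ {u} _ → sym (sum-filterᵇ (adj G u) (λ v → g v u) V)) ⟩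
    sum (map (λ u → sum (map (λ v → g v u) (nbrs G u))) V) ∎
    where
    open ≡-Reasoning
    V = allFin n

-- Double counting in a properly 2-coloured graph

class-split : ∀ a s k →
  k ≡ (if does (a ≟ᴮ s) then k else 0) + (if does (a ≟ᴮ not s) then k else 0)
class-split true  true  k = sym (+-identityʳ k)
class-split true  false k = refl
class-split false true  k = refl
class-split false false k = sym (+-identityʳ k)

black-or-white : ∀ c → c ≡ true ⊎ c ≡ false
black-or-white true  = inj₁ refl
black-or-white false = inj₂ refl

class-flip : ∀ a s → does (not a ≟ᴮ not s) ≡ does (a ≟ᴮ s)
class-flip true  true  = refl
class-flip true  false = refl
class-flip false true  = refl
class-flip false false = refl

module Bipartite {n : ℕ} (G : Graph n) (col : Fin n → Bool) (pc : ProperColouring G col) where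
  open Neighbourhoods G

  opposite : ∀ {v u} → adj G v u ≡ true → col u ≡ not (col v)
  opposite e = ¬-not (pc _ _ (adj-sym e))

  edge-colours : ∀ {v u} → adj G v u ≡ true →
                 (col v ≡ true × col u ≡ false) ⊎ (col v ≡ false × col u ≡ true)
  edge-colours {v} e with col v | opposite e
  ... | true  | cu = inj₁ (refl , cu)
  ... | false | cu = inj₂ (refl , cu)

  classSum : Bool → EdgeFun n → ℕ
  classSum s f = sum (map (λ v → if does (col v ≟ᴮ s) then load G f v else 0) (allFin n))

  total-split : ∀ s f → total2 G f ≡ classSum s f + classSum (not s) f
  total-split s f =
    trans (sum-cong∈ _ _ (allFin n) (λ {v} _ → class-split (col v) s (load G f v)))
          (sum-map-+ _ _ (allFin n))

  -- Every edge has one endpoint in each class, so a symmetric f has equal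
  -- load on both classes.
  class-balance : ∀ s f → Symmetric G f → classSum (not s) f ≡ classSum s f
  class-balance s f f-sym = begin
    classSum (not s) f
      ≡⟨ sum-cong∈ _ _ V (λ {v} _ → sum-when (does (col v ≟ᴮ not s)) (f v) (nbrs G v)) ⟩
    sum (map (λ v → sum (map (λ u → if does (col v ≟ᴮ not s) then f v u else 0) (nbrs G v))) V)
      ≡⟨ edge-sum-swap (λ v u → if does (col v ≟ᴮ not s) then f v u else 0) ⟩
    sum (map (λ v → sum (map (λ u → if does (col u ≟ᴮ not s) then f u v else 0) (nbrs G v))) V)
      ≡⟨ sum-cong∈ _ _ V (λ {v} _ → sum-cong∈ _ _ (nbrs G v) (λ u∈ →
           let e = ∈-nbrs⁻ u∈ in
           cong₂ (if_then_else 0) (trans (cong (λ c → does (c ≟ᴮ not s)) (opposite e))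
                                         (class-flip (col v) s))
                                  (f-sym _ _ (adj-sym e)))) ⟩
    sum (map (λ v → sum (map (λ u → if does (col v ≟ᴮ s) then f v u else 0) (nbrs G v))) V)
      ≡⟨ sum-cong∈ _ _ V (λ {v} _ → sym (sum-when (does (col v ≟ᴮ s)) (f v) (nbrs G v))) ⟩
    classSum s f ∎
    where
    open ≡-Reasoning
    V = allFin n

  compare-on-class : ∀ s c f g → Symmetric G f → Symmetric G g →
                     (∀ v → col v ≡ s → load G f v ≤ c * load G g v) →
                     total2 G f ≤ c * total2 G g
  compare-on-class s c f g f-sym g-sym le = begin
    total2 G f                               ≡⟨ total-split s f ⟩
    classSum s f + classSum (not s) f        ≡⟨ cong (classSum s f +_) (class-balance s f f-sym) ⟩
    classSum s f + classSum s f              ≤⟨ +-mono-≤ on-class on-class ⟩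
    c * classSum s g + c * classSum s g      ≡⟨ cong (λ t → c * classSum s g + c * t) (sym (class-balance s g g-sym)) ⟩
    c * classSum s g + c * classSum (not s) g ≡⟨ sym (*-distribˡ-+ c _ _) ⟩
    c * (classSum s g + classSum (not s) g)  ≡⟨ cong (c *_) (sym (total-split s g)) ⟩
    c * total2 G g                           ∎
    where
    open ≤-Reasoning
    pointwise : ∀ v → (if does (col v ≟ᴮ s) then load G f v else 0)
                      ≤ c * (if does (col v ≟ᴮ s) then load G g v else 0)
    pointwise v with col v ≟ᴮ s
    ... | yes cv≡s = le v cv≡s
    ... | no  _    = z≤n
    on-class : classSum s f ≤ c * classSum s g
    on-class = ≤-trans (sum-mono∈ _ _ (allFin n) (λ {v} _ → pointwise v))
                       (≤-reflexive (sum-map-* c _ (allFin n)))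

-- The algorithm

proposals : ℕ → List ℕ → List Bool
proposals b xs = firstTrues b (map positive xs)

record NodeState : Set where
  constructor node
  field
    black    : Bool
    capacity : ℕ
    weights  : List ℕ
    inbox    : List (List Bool)   -- messages received so far, latest round first

-- message on a port: black nodes propose in round 1, white nodes answer in
-- round 2 by accepting the first (capacity) proposals they received
message : NodeState → ℕ → Bool
message (node true  b xs [])      p = at false (proposals b xs) p
message (node false b xs (r ∷ _)) p = at false (firstTrues b r) p
message _                         p = false

-- after round 2 a black node keeps the edges whose proposal was accepted and
-- a white node keeps the edges it accepted
decision : NodeState → ℕ → Bool
decision (node true  b xs (r₂ ∷ _))     p = at false r₂ p
decision (node false b xs (_ ∷ r₁ ∷ _)) p = at false (firstTrues b r₁) p
decision _                              p = false

proposeAccept : LocalAlg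
proposeAccept = record
  { State  = NodeState
  ; Msg    = Bool
  ; init   = λ _ b c xs → node c b xs []
  ; send   = message
  ; recv   = λ s ms → node (NodeState.black s) (NodeState.capacity s) (NodeState.weights s)
                           (ms ∷ NodeState.inbox s)
  ; output = decision
  }

-- Analysis of a run

module Execution {n : ℕ} (G : Graph n) (ident : Fin n → ℕ) (col : Fin n → Bool)
                 (b : Fin n → ℕ) (x : EdgeFun n) (pc : ProperColouring G col) where
  open Neighbourhoods G
  open Bipartite G col pc

  state : ℕ → Fin n → NodeState
  state = run proposeAccept G ident col b x

  -- the messages v receives in round r + 1, by port
  received : ℕ → Fin n → List Bool
  received r v = map (λ u → message (state r u) (portOf G u v)) (nbrs G v)

  delivered : ∀ r {v u} → adj G v u ≡ true →
              at false (received r v) (portOf G v u) ≡ message (state r u) (portOf G u v)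
  delivered r e = at-port false _ _ (∈-nbrs⁺ e)

  Y : EdgeFun n
  Y = result proposeAccept G ident col b x 2

  Y-edge : ∀ {v u} → adj G v u ≡ true → Y v u ≡ bit (decision (state 2 v) (portOf G v u))
  Y-edge e rewrite e = refl

  proposal : Fin n → Fin n → ℕ
  proposal v u = bit (at false (proposals (b v) (map (x v) (nbrs G v))) (portOf G v u))

  acceptance : Fin n → Fin n → ℕ
  acceptance u v = bit (at false (firstTrues (b u) (received 0 u)) (portOf G u v))

  P : EdgeFun n
  P v u = if col v then proposal v u else proposal u v

  proposal-received : ∀ {u v} → adj G u v ≡ true → col v ≡ true →
                      bit (at false (received 0 u) (portOf G u v)) ≡ proposal v u
  proposal-received e cv rewrite delivered 0 e | cv = refl

  Y-white : ∀ {u v} → adj G u v ≡ true → col u ≡ false → Y u v ≡ acceptance u v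
  Y-white e cu rewrite Y-edge e | cu = refl

  Y-black : ∀ {v u} → adj G v u ≡ true → col v ≡ true → Y v u ≡ acceptance u v
  Y-black {v} {u} e cv rewrite Y-edge e | cv | delivered 1 e | opposite e | cv = refl

  P-sym : Symmetric G P
  P-sym v u e with edge-colours e
  ... | inj₁ (cv , cu) rewrite cv | cu = refl
  ... | inj₂ (cv , cu) rewrite cv | cu = refl

  Y-sym : Symmetric G Y
  Y-sym v u e with edge-colours e
  ... | inj₁ (cv , cu) = trans (Y-black e cv) (sym (Y-white (adj-sym e) cu))
  ... | inj₂ (cv , cu) = trans (Y-white e cv) (sym (Y-black (adj-sym e) cu))

  Y≤P-black : ∀ {v u} → adj G v u ≡ true → col v ≡ true → Y v u ≤ P v u
  Y≤P-black {v} {u} e cv rewrite Y-black e cv | cv =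
    subst (acceptance u v ≤_) (proposal-received (adj-sym e) cv)
          (firstTrues-below (b u) (received 0 u) (portOf G u v))

  load-Y-white : ∀ u → col u ≡ false → load G Y u ≡ b u ⊓ trues (received 0 u)
  load-Y-white u cu = begin
    load G Y u                                  ≡⟨ sum-cong∈ _ _ (nbrs G u) (λ u∈ → Y-white (∈-nbrs⁻ u∈) cu) ⟩
    sum (map (acceptance u) (nbrs G u))         ≡⟨ sum-by-ports (nbrs G u) (firstTrues (b u) (received 0 u)) (nbrs-unique u) len ⟩
    trues (firstTrues (b u) (received 0 u))     ≡⟨ trues-firstTrues (b u) (received 0 u) ⟩
    b u ⊓ trues (received 0 u)                  ∎
    where
    open ≡-Reasoning
    len : length (firstTrues (b u) (received 0 u)) ≡ length (nbrs G u)
    len = trans (length-firstTrues (b u) (received 0 u)) (length-map _ (nbrs G u))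

  load-P-white : ∀ u → col u ≡ false → load G P u ≡ trues (received 0 u)
  load-P-white u cu = begin
    load G P u                                  ≡⟨ sum-cong∈ _ _ (nbrs G u) P-received ⟩
    sum (map (λ v → bit (at false (received 0 u) (portOf G u v))) (nbrs G u))
                                                ≡⟨ sum-by-ports (nbrs G u) (received 0 u) (nbrs-unique u) (length-map _ (nbrs G u)) ⟩
    trues (received 0 u)                        ∎
    where
    open ≡-Reasoning
    P-received : ∀ {v} → v ∈ nbrs G u → P u v ≡ bit (at false (received 0 u) (portOf G u v))
    P-received {v} v∈ rewrite cu =
      let e = ∈-nbrs⁻ v∈ in sym (proposal-received e (trans (opposite e) (cong not cu)))

  load-P-black : ∀ v → col v ≡ true → load G P v ≡ b v ⊓ trues (map positive (map (x v) (nbrs G v)))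
  load-P-black v cv = begin
    load G P v                                  ≡⟨ sum-cong∈ _ _ (nbrs G v) (λ _ → cong (if_then proposal v _ else proposal _ v) cv) ⟩
    sum (map (proposal v) (nbrs G v))           ≡⟨ sum-by-ports (nbrs G v) (proposals (b v) xs) (nbrs-unique v) len ⟩
    trues (proposals (b v) xs)                  ≡⟨ trues-firstTrues (b v) (map positive xs) ⟩
    b v ⊓ trues (map positive xs)               ∎
    where
    open ≡-Reasoning
    xs : List ℕ
    xs = map (x v) (nbrs G v)
    len : length (proposals (b v) xs) ≡ length (nbrs G v)
    len = trans (length-firstTrues (b v) (map positive xs))
                (trans (length-map positive xs) (length-map (x v) (nbrs G v)))

  Y≤1 : ∀ v u → Y v u ≤ 1
  Y≤1 v u with adj G v u
  ... | true  = bit≤1 _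
  ... | false = z≤n

  load-Y≤b : ∀ v → load G Y v ≤ b v
  load-Y≤b v with black-or-white (col v)
  ... | inj₂ cv = subst (_≤ b v) (sym (load-Y-white v cv)) (m⊓n≤m (b v) _)
  ... | inj₁ cv = begin
    load G Y v  ≤⟨ sum-mono∈ _ _ (nbrs G v) (λ u∈ → Y≤P-black (∈-nbrs⁻ u∈) cv) ⟩
    load G P v  ≡⟨ load-P-black v cv ⟩
    b v ⊓ _     ≤⟨ m⊓n≤m (b v) _ ⟩
    b v         ∎
    where open ≤-Reasoning

  Y-integral : IntegralBMatching G b Y
  Y-integral = Y-sym , Y≤1 , load-Y≤b

  -- the rounding loses at most a factor 16 on each side
  module Approximation (fm : Frac4BMatching G b x) where
    x-sym : Symmetric G x
    x-sym = proj₁ fm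

    x≤16 : ∀ v u → x v u ≤ 16
    x≤16 v u with proj₁ (proj₂ fm) v u
    ... | inj₁ x≡0             = subst (_≤ 16) (sym x≡0) z≤n
    ... | inj₂ (j , j≤4 , x≡2ʲ) = subst (_≤ 16) (sym x≡2ʲ) (^-monoʳ-≤ 2 j≤4)

    -- a proposal is only made along an edge with positive (hence ≥ 1) value
    proposal≤x : ∀ {v u} → adj G v u ≡ true → proposal v u ≤ x v u
    proposal≤x {v} {u} e = begin
      proposal v u                                       ≤⟨ firstTrues-below (b v) (map positive xs) p ⟩
      bit (at false (map positive xs) p)                 ≡⟨ cong bit (at-map positive 0 xs p) ⟩
      bit (positive (at 0 xs p))                         ≡⟨ cong (bit ∘ positive) (at-port 0 (x v) (nbrs G v) (∈-nbrs⁺ e)) ⟩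
      bit (positive (x v u))                             ≤⟨ bit-positive (x v u) ⟩
      x v u                                              ∎
      where
      open ≤-Reasoning
      xs : List ℕ
      xs = map (x v) (nbrs G v)
      p : ℕ
      p = portOf G v u

    black-step : ∀ v → col v ≡ true → load G x v ≤ 16 * load G P v
    black-step v cv = subst (λ t → load G x v ≤ 16 * t) (sym (load-P-black v cv))
      (≤-*-⊓ 16 (b v) _ (proj₂ (proj₂ fm) v)
                (sum≤cap*positives 16 (map (x v) (nbrs G v)) (map⁺ (All.universal (x≤16 v) (nbrs G v)))))

    white-step : ∀ u → col u ≡ false → load G P u ≤ 16 * load G Y u
    white-step u cu = subst₂ (λ k t → k ≤ 16 * t) (sym (load-P-white u cu)) (sym (load-Y-white u cu))
      (≤-*-⊓ 16 (b u) (trues (received 0 u)) (subst (_≤ 16 * b u) (load-P-white u cu) P≤16b) (m≤n*m (trues (received 0 u)) 16))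
      where
      P≤x : ∀ {v} → v ∈ nbrs G u → P u v ≤ x u v
      P≤x {v} v∈ rewrite cu =
        let e = ∈-nbrs⁻ v∈ in subst (proposal v u ≤_) (x-sym v u (adj-sym e)) (proposal≤x (adj-sym e))
      P≤16b : load G P u ≤ 16 * b u
      P≤16b = ≤-trans (sum-mono∈ _ _ (nbrs G u) P≤x) (proj₂ (proj₂ fm) u)

    total-bound : total2 G x ≤ 16 * (16 * total2 G Y)
    total-bound = ≤-trans (compare-on-class true 16 x P x-sym P-sym black-step)
                          (*-monoʳ-≤ 16 (compare-on-class false 16 P Y P-sym Y-sym white-step))

-- 16·m ≤ 14·256·t gives m ≤ 224·t ≤ 434·t
approximation-ratio : ∀ m t → 16 * m ≤ 14 * (16 * (16 * t)) → m ≤ 434 * t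
approximation-ratio m t h = ≤-trans (*-cancelˡ-≤ 16 (subst (16 * m ≤_) scale h)) (*-monoˡ-≤ t 224≤434)
  where
  scale : 14 * (16 * (16 * t)) ≡ 16 * (224 * t)
  scale = trans (cong (14 *_) (sym (*-assoc 16 16 t)))
                (trans (sym (*-assoc 14 256 t)) (*-assoc 16 224 t))
  224≤434 : 224 ≤ 434
  224≤434 = m≤m+n 224 210

lemma6p4 : Σ LocalAlg (λ A → Σ ℕ (λ r →
             ∀ (n : ℕ) (G : Graph n) (ident : Fin n → ℕ) (col : Fin n → Bool)
               (b : Fin n → ℕ) (x : EdgeFun n) →
             Injective _≡_ _≡_ ident → ProperColouring G col → ValidB G b →
             Frac4BMatching G b x → Frac4Approx 14 G b x →
             IntegralBMatching G b (result A G ident col b x r)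
               × IntApprox 434 G b (result A G ident col b x r)))
lemma6p4 = proposeAccept , 2 , λ n G ident col b x _ pc _ fm x-approx →
  let open Execution G ident col b x pc
      open Approximation fm
  in Y-integral ,
     λ M M-int → approximation-ratio (total2 G M) (total2 G Y)
                   (≤-trans (x-approx M M-int) (*-monoʳ-≤ 14 total-bound))
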